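{- Let $a,b,c$ be positive integers with $\gcd(a,b,c)=1$ and $a$ odd, and let $f(x,y,z)=ax^2+by^2+cz^2$. Assume that $a+b+c$ is odd. Then for any positive integer $n$, $$t(a,b,c;n)=r\big(g,\,8n+a+b+c\big),\qquad\text{where } g(x,y,z)=f(x,x-2y,x-2z)=ax^2+b(x-2y)^2+c(x-2z)^2.$$ In particular, if moreover $a\equiv b\equiv c \pmod 4$, then $t(a,b,c;n)=r(f,8n+a+b+c)$.
   Context: For positive integers $a,b,c$ and an integer $n$, $t(a,b,c;n)$ denotes the number of $(x,y,z)\in\mathbb Z^3$ with $a\frac{x(x-1)}2+b\frac{y(y-1)}2+c\frac{z(z-1)}2=n$. For a positive definite integral quadratic form $h$ in $k$ variables and an integer $m$, $r(h,m)$ denotes the number of $v\in\mathbb Z^k$ with $h(v)=m$. -}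

module Defs where

open import Data.Nat using (ℕ)
open import Data.Integer using (ℤ; +_; _+_; _-_; _*_)
open import Data.Product using (Σ; _×_; _,_)
open import Data.Fin using (Fin)
open import Function.Bundles using (_↔_)
open import Relation.Binary.PropositionalEquality using (_≡_)

ℤ³ : Set
ℤ³ = ℤ × ℤ × ℤ

Rep : (ℤ³ → ℤ) → ℤ → Set
Rep h m = Σ ℤ³ (λ v → h v ≡ m)

HasCard : Set → ℕ → Set
HasCard S k = Fin k ↔ S

r≡ : (ℤ³ → ℤ) → ℤ → ℕ → Set
r≡ h m k = HasCard (Rep h m) k

-- twice the triangular-type form:
-- 2 (a x(x-1)/2 + b y(y-1)/2 + c z(z-1)/2) = a x(x-1) + b y(y-1) + c z(z-1)
twiceTri : ℕ → ℕ → ℕ → ℤ³ → ℤ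
twiceTri a b c (x , y , z) =
  + a * (x * (x - + 1)) + + b * (y * (y - + 1)) + + c * (z * (z - + 1))

-- t(a,b,c;n) = k : the number of (x,y,z) ∈ ℤ³ with
-- a x(x-1)/2 + b y(y-1)/2 + c z(z-1)/2 = n is k
-- (equation multiplied by 2; x(x-1) is always even so this is equivalent)
t≡ : ℕ → ℕ → ℕ → ℤ → ℕ → Set
t≡ a b c n k = HasCard (Rep (twiceTri a b c) (+ 2 * n)) k

f : ℕ → ℕ → ℕ → ℤ³ → ℤ
f a b c (x , y , z) = + a * (x * x) + + b * (y * y) + + c * (z * z)

g : ℕ → ℕ → ℕ → ℤ³ → ℤ
g a b c (x , y , z) = f a b c (x , x - + 2 * y , x - + 2 * z)

module Submission where

-- Write S = a + b + c and N = 8n + S = 4·(2n) + S.  Everything rests on the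
-- polynomial identity
--     f(2X − 1, 2Y − 1, 2Z − 1) = 4·(aX(X − 1) + bY(Y − 1) + cZ(Z − 1)) + S,
-- so X ↦ 2X − 1 (coordinatewise) turns solutions of twiceTri = 2n into
-- solutions of f = N whose coordinates are all odd, with inverse x ↦ ⌈x/2⌉.
--   * Since g(x, y, z) = f(x, x − 2y, x − 2z) and (2X − 1) − 2(X − Y) = 2Y − 1,
--     the map (X, Y, Z) ↦ (2X − 1, X − Y, X − Z) sends the triangular solutions
--     to solutions of g = N.  It is a bijection because N is odd: if x were even,
--     g(x, y, z) = f(x, x − 2y, x − 2z) would be a multiple of 4.
--   * If moreover a ≡ b ≡ c (mod 4) with a odd, reducing f = N modulo 4
--     (squares are 0 or 1 mod 4) leaves a·(3 − #odd coordinates) ≡ 0 (mod 4),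
--     which forces all three coordinates to be odd.

open import Defs
open import Data.Product using (Σ; _,_; proj₁; proj₂)
open import Function.Bundles using (_↔_; mk↔ₛ′)
open import Function.Construct.Composition using (_↔-∘_)
open import Relation.Binary.PropositionalEquality
  using (_≡_; _≢_; refl; sym; trans; cong; cong₂; module ≡-Reasoning)

module Fibres where
  open import Data.Nat as ℕ using (ℕ; suc; s≤s)
  open import Data.Nat.DivMod as ℕ using (_%_; _/_)
  import Data.Nat.Properties as ℕ
  open import Data.Integer using (ℤ; +_; -_; _+_; _-_; _*_; ∣_∣)
  open import Data.Integer.DivMod using (_%ℕ_; _/ℕ_; n%ℕd<d; a≡a%ℕn+[a/ℕn]*n)
  open import Data.Integer.Properties
    using (_≟_; +-0-abelianGroup; *-cancelˡ-≡; abs-*; pos-+; pos-*)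
  open import Algebra.Properties.AbelianGroup +-0-abelianGroup using (∙-cancelʳ)
  open import Data.Integer.Tactic.RingSolver using (solve-∀)
  open import Data.Product using (_×_)
  open import Data.Product.Properties using (Σ-≡,≡→≡)
  open import Data.Empty using (⊥-elim)
  open import Axiom.UniquenessOfIdentityProofs using (module Decidable⇒UIP)
  open ≡-Reasoning

  -- Parity of integers.  Odd numbers are written 2X − 1, the shape produced
  -- by the maps of this proof.

  data Parity (x : ℤ) : Set where
    even : (p : ℤ) → x ≡ + 2 * p → Parity x
    odd  : (X : ℤ) → x ≡ + 2 * X - + 1 → Parity x

  Odd : ℤ → Set
  Odd x = Σ ℤ λ X → x ≡ + 2 * X - + 1

  even-form : ∀ q → + 0 + q * + 2 ≡ + 2 * q
  even-form = solve-∀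

  odd-form : ∀ q → + 1 + q * + 2 ≡ + 2 * (q + + 1) - + 1
  odd-form = solve-∀

  parity : (x : ℤ) → Parity x
  parity x with x %ℕ 2 | n%ℕd<d x 2 | a≡a%ℕn+[a/ℕn]*n x 2
  ... | 0           | _            | x≡ = even (x /ℕ 2) (trans x≡ (even-form (x /ℕ 2)))
  ... | 1           | _            | x≡ = odd (x /ℕ 2 + + 1) (trans x≡ (odd-form (x /ℕ 2)))
  ... | suc (suc _) | s≤s (s≤s ()) | _

  ℕ-divMod : ∀ n d .{{_ : ℕ.NonZero d}} → + n ≡ + (n % d) + + (n / d) * + d
  ℕ-divMod n d = begin
    + n                          ≡⟨ cong +_ (ℕ.m≡m%n+[m/n]*n n d) ⟩
    + (n % d ℕ.+ n / d ℕ.* d)    ≡⟨ pos-+ (n % d) (n / d ℕ.* d) ⟩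
    + (n % d) + + (n / d ℕ.* d)  ≡⟨ cong (λ t → + (n % d) + t) (pos-* (n / d) d) ⟩
    + (n % d) + + (n / d) * + d  ∎

  ℕ-odd : ∀ n → n % 2 ≡ 1 → Odd (+ n)
  ℕ-odd n n%2≡1 = + (n / 2) + + 1 , (begin
    + n                          ≡⟨ ℕ-divMod n 2 ⟩
    + (n % 2) + + (n / 2) * + 2  ≡⟨ cong (λ r → + r + + (n / 2) * + 2) n%2≡1 ⟩
    + 1 + + (n / 2) * + 2        ≡⟨ odd-form (+ (n / 2)) ⟩
    + 2 * (+ (n / 2) + + 1) - + 1 ∎)

  ℕ-≡-mod4 : ∀ m n → m % 4 ≡ n % 4 → Σ ℤ λ β → + n ≡ + m + + 4 * β
  ℕ-≡-mod4 m n m≡n = qn - qm , (begin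
    + n                                  ≡⟨ ℕ-divMod n 4 ⟩
    + (n % 4) + qn * + 4                 ≡⟨ cong (λ r → + r + qn * + 4) (sym m≡n) ⟩
    + (m % 4) + qn * + 4                 ≡⟨ shift (+ (m % 4)) qm qn ⟩
    + (m % 4) + qm * + 4 + + 4 * (qn - qm) ≡⟨ cong (_+ + 4 * (qn - qm)) (sym (ℕ-divMod m 4)) ⟩
    + m + + 4 * (qn - qm)                ∎)
    where
    qm qn : ℤ
    qm = + (m / 4)
    qn = + (n / 4)
    shift : ∀ r q q′ → r + q′ * + 4 ≡ r + q * + 4 + + 4 * (q′ - q)
    shift = solve-∀

  twice≢one : ∀ r → + 2 * r ≢ + 1
  twice≢one r 2r≡1 with ℕ.m*n≡1⇒m≡1 2 ∣ r ∣ (trans (sym (abs-* (+ 2) r)) (cong ∣_∣ 2r≡1))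
  ... | ()

  even≢odd : ∀ p X → + 2 * p ≢ + 2 * X - + 1
  even≢odd p X e = twice≢one (X - p) (begin
    + 2 * (X - p)               ≡⟨ difference X p ⟩
    (+ 2 * X - + 1) - + 2 * p + + 1 ≡⟨ cong (λ t → t - + 2 * p + + 1) (sym e) ⟩
    + 2 * p - + 2 * p + + 1     ≡⟨ cancel p ⟩
    + 1                         ∎)
    where
    difference : ∀ X p → + 2 * (X - p) ≡ (+ 2 * X - + 1) - + 2 * p + + 1
    difference = solve-∀
    cancel : ∀ p → + 2 * p - + 2 * p + + 1 ≡ + 1
    cancel = solve-∀

  odd-injective : ∀ {X Y} → + 2 * X - + 1 ≡ + 2 * Y - + 1 → X ≡ Y
  odd-injective {X} {Y} e = *-cancelˡ-≡ (+ 2) X Y (∙-cancelʳ (- + 1) (+ 2 * X) (+ 2 * Y) e)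

  ⌈_/2⌉ : ℤ → ℤ
  ⌈ x /2⌉ with parity x
  ... | even p _ = p
  ... | odd X _  = X

  ⌈/2⌉-odd : ∀ {x X} → x ≡ + 2 * X - + 1 → ⌈ x /2⌉ ≡ X
  ⌈/2⌉-odd {x} {X} x≡ with parity x
  ... | even p x≡′ = ⊥-elim (even≢odd p X (trans (sym x≡′) x≡))
  ... | odd X′ x≡′ = odd-injective (trans (sym x≡′) x≡)

  odd-⌈/2⌉ : ∀ {x} → Odd x → x ≡ + 2 * ⌈ x /2⌉ - + 1
  odd-⌈/2⌉ {x} (X , x≡) = trans x≡ (cong (λ t → + 2 * t - + 1) (sym (⌈/2⌉-odd {x} {X} x≡)))

  bit : ∀ {x} → Parity x → ℤ
  bit (even _ _) = + 0
  bit (odd _ _)  = + 1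

  squareQuotient : ∀ {x} → Parity x → ℤ
  squareQuotient (even p _) = p * p
  squareQuotient (odd X _)  = X * X - X

  square-mod4 : ∀ {x} (π : Parity x) → x * x ≡ + 4 * squareQuotient π + bit π
  square-mod4 (even p refl) = even-square p
    where
    even-square : ∀ p → (+ 2 * p) * (+ 2 * p) ≡ + 4 * (p * p) + + 0
    even-square = solve-∀
  square-mod4 (odd X refl) = odd-square X
    where
    odd-square : ∀ X → (+ 2 * X - + 1) * (+ 2 * X - + 1) ≡ + 4 * (X * X - X) + + 1
    odd-square = solve-∀

  mod4-reduction : ∀ {A B C u v w} (β γ m : ℤ) → B ≡ A + + 4 * β → C ≡ A + + 4 * γ →
    (πu : Parity u) (πv : Parity v) (πw : Parity w) →
    A * (u * u) + B * (v * v) + C * (w * w) ≡ + 4 * m + (A + B + C) →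
    Σ ℤ λ K → A * (+ 3 - (bit πu + bit πv + bit πw)) ≡ + 4 * K
  mod4-reduction {A} {u = u} {v} {w} β γ m refl refl πu πv πw e = K , (begin
    A * (+ 3 - (eu + ev + ew))     ≡⟨ identity A β γ m qu qv qw eu ev ew ⟩
    + 4 * K + (N - F′)             ≡⟨ cong (λ t → + 4 * K + (N - t)) (sym squares) ⟩
    + 4 * K + (N - F)              ≡⟨ cong (λ t → + 4 * K + (N - t)) e ⟩
    + 4 * K + (N - N)              ≡⟨ vanish (+ 4 * K) N ⟩
    + 4 * K                        ∎)
    where
    B C N qu qv qw eu ev ew K F F′ : ℤ
    B = A + + 4 * β
    C = A + + 4 * γ
    N = + 4 * m + (A + B + C)
    qu = squareQuotient πu
    qv = squareQuotient πv
    qw = squareQuotient πw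
    eu = bit πu
    ev = bit πv
    ew = bit πw
    K = A * (qu + qv + qw) + β * (+ 4 * qv + ev) + γ * (+ 4 * qw + ew) - m - β - γ
    F = A * (u * u) + B * (v * v) + C * (w * w)
    F′ = A * (+ 4 * qu + eu) + B * (+ 4 * qv + ev) + C * (+ 4 * qw + ew)
    squares : F ≡ F′
    squares = cong₂ _+_ (cong₂ _+_ (cong (A *_) (square-mod4 πu)) (cong (B *_) (square-mod4 πv)))
                        (cong (C *_) (square-mod4 πw))
    identity : ∀ A β γ m qu qv qw eu ev ew →
      A * (+ 3 - (eu + ev + ew))
        ≡ + 4 * (A * (qu + qv + qw) + β * (+ 4 * qv + ev) + γ * (+ 4 * qw + ew) - m - β - γ)
          + ((+ 4 * m + (A + (A + + 4 * β) + (A + + 4 * γ)))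
             - (A * (+ 4 * qu + eu) + (A + + 4 * β) * (+ 4 * qv + ev) + (A + + 4 * γ) * (+ 4 * qw + ew)))
    identity = solve-∀
    vanish : ∀ t N → t + (N - N) ≡ t
    vanish = solve-∀

  data OneTwoThree : ℤ → Set where
    one   : OneTwoThree (+ 1)
    two   : OneTwoThree (+ 2)
    three : OneTwoThree (+ 3)

  twice-twice : ∀ K → + 2 * (+ 2 * K) ≡ + 4 * K
  twice-twice = solve-∀

  odd*small≢4* : ∀ {A k K} → Odd A → OneTwoThree k → A * k ≢ + 4 * K
  odd*small≢4* {A} {K = K} (σ , refl) one e = even≢odd (+ 2 * K) σ (begin
    + 2 * (+ 2 * K)     ≡⟨ twice-twice K ⟩
    + 4 * K             ≡⟨ sym e ⟩
    A * + 1             ≡⟨ times1 σ ⟩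
    + 2 * σ - + 1       ∎)
    where
    times1 : ∀ σ → (+ 2 * σ - + 1) * + 1 ≡ + 2 * σ - + 1
    times1 = solve-∀
  odd*small≢4* {A} {K = K} (σ , refl) two e = even≢odd K σ (*-cancelˡ-≡ (+ 2) (+ 2 * K) A (begin
    + 2 * (+ 2 * K)     ≡⟨ twice-twice K ⟩
    + 4 * K             ≡⟨ sym e ⟩
    A * + 2             ≡⟨ swap A ⟩
    + 2 * A             ∎))
    where
    swap : ∀ A → A * + 2 ≡ + 2 * A
    swap = solve-∀
  odd*small≢4* {A} {K = K} (σ , refl) three e = even≢odd (+ 2 * K) (+ 3 * σ - + 1) (begin
    + 2 * (+ 2 * K)     ≡⟨ twice-twice K ⟩
    + 4 * K             ≡⟨ sym e ⟩
    A * + 3             ≡⟨ times3 σ ⟩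
    + 2 * (+ 3 * σ - + 1) - + 1 ∎)
    where
    times3 : ∀ σ → (+ 2 * σ - + 1) * + 3 ≡ + 2 * (+ 3 * σ - + 1) - + 1
    times3 = solve-∀

  -- Consequently, under the conclusion of mod4-reduction with A odd, all
  -- three coordinates are odd: otherwise 3 − #odd coordinates is 1, 2 or 3.
  all-odd : ∀ {A u v w} → Odd A → (πu : Parity u) (πv : Parity v) (πw : Parity w) →
    Σ ℤ (λ K → A * (+ 3 - (bit πu + bit πv + bit πw)) ≡ + 4 * K) → Odd u × Odd v × Odd w
  all-odd _ (odd X u≡) (odd Y v≡) (odd Z w≡) _ = (X , u≡) , (Y , v≡) , (Z , w≡)
  all-odd oddA (even _ _) (odd _ _)  (odd _ _)  (_ , e) = ⊥-elim (odd*small≢4* oddA one e)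
  all-odd oddA (odd _ _)  (even _ _) (odd _ _)  (_ , e) = ⊥-elim (odd*small≢4* oddA one e)
  all-odd oddA (odd _ _)  (odd _ _)  (even _ _) (_ , e) = ⊥-elim (odd*small≢4* oddA one e)
  all-odd oddA (odd _ _)  (even _ _) (even _ _) (_ , e) = ⊥-elim (odd*small≢4* oddA two e)
  all-odd oddA (even _ _) (odd _ _)  (even _ _) (_ , e) = ⊥-elim (odd*small≢4* oddA two e)
  all-odd oddA (even _ _) (even _ _) (odd _ _)  (_ , e) = ⊥-elim (odd*small≢4* oddA two e)
  all-odd oddA (even _ _) (even _ _) (even _ _) (_ , e) = ⊥-elim (odd*small≢4* oddA three e)

  -- Two maps of ℤ³ that send the fibre h = m into
  -- h′ = m′ and back, and are mutually inverse there, induce a bijection of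
  -- the fibres: proofs of equalities in ℤ are unique.
  fibre-↔ : {h h′ : ℤ³ → ℤ} {m m′ : ℤ} (to from : ℤ³ → ℤ³) →
    (∀ v → h v ≡ m → h′ (to v) ≡ m′) → (∀ w → h′ w ≡ m′ → h (from w) ≡ m) →
    (∀ w → h′ w ≡ m′ → to (from w) ≡ w) → (∀ v → h v ≡ m → from (to v) ≡ v) →
    Rep h m ↔ Rep h′ m′
  fibre-↔ to from to-ok from-ok to∘from from∘to =
    mk↔ₛ′ (λ (v , e) → to v , to-ok v e) (λ (w , e) → from w , from-ok w e)
          (λ (w , e) → same-point (to∘from w e)) (λ (v , e) → same-point (from∘to v e))
    where
    same-point : ∀ {k n} {p q : Rep k n} → proj₁ p ≡ proj₁ q → p ≡ q
    same-point p≡q = Σ-≡,≡→≡ (p≡q , Decidable⇒UIP.≡-irrelevant _≟_ _ _)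

  triple-≡ : ∀ {x x′ y y′ z z′ : ℤ} → x ≡ x′ → y ≡ y′ → z ≡ z′ → (x , y , z) ≡ (x′ , y′ , z′)
  triple-≡ x≡ y≡ z≡ = cong₂ _,_ x≡ (cong₂ _,_ y≡ z≡)

  oddPoint : ℤ³ → ℤ³
  oddPoint (X , Y , Z) = + 2 * X - + 1 , + 2 * Y - + 1 , + 2 * Z - + 1

  f-oddPoint : ∀ a b c v → f a b c (oddPoint v) ≡ + 4 * twiceTri a b c v + (+ a + + b + + c)
  f-oddPoint a b c (X , Y , Z) = identity (+ a) (+ b) (+ c) X Y Z
    where
    identity : ∀ A B C X Y Z →
      A * ((+ 2 * X - + 1) * (+ 2 * X - + 1)) + B * ((+ 2 * Y - + 1) * (+ 2 * Y - + 1))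
        + C * ((+ 2 * Z - + 1) * (+ 2 * Z - + 1))
      ≡ + 4 * (A * (X * (X - + 1)) + B * (Y * (Y - + 1)) + C * (Z * (Z - + 1))) + (A + B + C)
    identity = solve-∀

  f-double : ∀ a b c p q r → f a b c (+ 2 * p , + 2 * q , + 2 * r) ≡ + 2 * (+ 2 * f a b c (p , q , r))
  f-double a b c = identity (+ a) (+ b) (+ c)
    where
    identity : ∀ A B C p q r →
      A * ((+ 2 * p) * (+ 2 * p)) + B * ((+ 2 * q) * (+ 2 * q)) + C * ((+ 2 * r) * (+ 2 * r))
      ≡ + 2 * (+ 2 * (A * (p * p) + B * (q * q) + C * (r * r)))
    identity = solve-∀

  shear : ℤ³ → ℤ³
  shear (x , y , z) = x , x - + 2 * y , x - + 2 * z

  shear-even : ∀ {x} p y z → x ≡ + 2 * p →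
    shear (x , y , z) ≡ (+ 2 * p , + 2 * (p - y) , + 2 * (p - z))
  shear-even p y z refl = triple-≡ refl (identity p y) (identity p z)
    where
    identity : ∀ p y → + 2 * p - + 2 * y ≡ + 2 * (p - y)
    identity = solve-∀

  shear-odd : ∀ {x} X y z → x ≡ + 2 * X - + 1 → shear (x , y , z) ≡ oddPoint (X , X - y , X - z)
  shear-odd X y z refl = triple-≡ refl (identity X y) (identity X z)
    where
    identity : ∀ X y → (+ 2 * X - + 1) - + 2 * y ≡ + 2 * (X - y) - + 1
    identity = solve-∀

  odd-shift : ∀ m {S} → Odd S → Odd (+ 4 * m + S)
  odd-shift m (σ , refl) = + 2 * m + σ , identity m σ
    where
    identity : ∀ m σ → + 4 * m + (+ 2 * σ - + 1) ≡ + 2 * (+ 2 * m + σ) - + 1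
    identity = solve-∀

  module _ (a b c : ℕ) (m N : ℤ) (N≡ : N ≡ + 4 * m + (+ a + + b + + c)) where

    oddPoint-solves : ∀ v → twiceTri a b c v ≡ m → f a b c (oddPoint v) ≡ N
    oddPoint-solves v e = begin
      f a b c (oddPoint v)                          ≡⟨ f-oddPoint a b c v ⟩
      + 4 * twiceTri a b c v + (+ a + + b + + c)    ≡⟨ cong (λ t → + 4 * t + (+ a + + b + + c)) e ⟩
      + 4 * m + (+ a + + b + + c)                   ≡⟨ sym N≡ ⟩
      N                                             ∎

    oddPoint-solves⁻¹ : ∀ v → f a b c (oddPoint v) ≡ N → twiceTri a b c v ≡ m
    oddPoint-solves⁻¹ v e = *-cancelˡ-≡ (+ 4) (twiceTri a b c v) m
      (∙-cancelʳ (+ a + + b + + c) _ _ (trans (sym (f-oddPoint a b c v)) (trans e N≡)))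

    -- For N odd, the first coordinate of a solution of g = N is odd: if x = 2p,
    -- then g(x, y, z) = f(2p, 2(p − y), 2(p − z)) = 4 f(p, p − y, p − z).
    g-solution-odd : Odd N → ∀ x y z → g a b c (x , y , z) ≡ N → Odd x
    g-solution-odd (ν , N≡odd) x y z e with parity x
    ... | odd X x≡  = X , x≡
    ... | even p x≡ = ⊥-elim (even≢odd (+ 2 * f a b c (p , p - y , p - z)) ν (begin
      + 2 * (+ 2 * f a b c (p , p - y , p - z))   ≡⟨ sym (f-double a b c p (p - y) (p - z)) ⟩
      f a b c (+ 2 * p , + 2 * (p - y) , + 2 * (p - z)) ≡⟨ cong (f a b c) (sym (shear-even p y z x≡)) ⟩
      g a b c (x , y , z)                         ≡⟨ e ⟩
      N                                           ≡⟨ N≡odd ⟩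
      + 2 * ν - + 1                               ∎))

    g-bijection : Odd (+ a + + b + + c) → Rep (twiceTri a b c) m ↔ Rep (g a b c) N
    g-bijection oddS = fibre-↔ {twiceTri a b c} {g a b c} to from to-ok from-ok to∘from from∘to
      where
      to from : ℤ³ → ℤ³
      to (X , Y , Z) = + 2 * X - + 1 , X - Y , X - Z
      from (x , y , z) = ⌈ x /2⌉ , ⌈ x /2⌉ - y , ⌈ x /2⌉ - z

      oddN : Odd N
      oddN = proj₁ (odd-shift m oddS) , trans N≡ (proj₂ (odd-shift m oddS))

      back : ∀ X y → X - (X - y) ≡ y
      back = solve-∀

      first-odd : ∀ x y z → g a b c (x , y , z) ≡ N → x ≡ + 2 * ⌈ x /2⌉ - + 1
      first-odd x y z e = odd-⌈/2⌉ (g-solution-odd oddN x y z e)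

      to-ok : ∀ v → twiceTri a b c v ≡ m → g a b c (to v) ≡ N
      to-ok (X , Y , Z) e = begin
        f a b c (shear (to (X , Y , Z)))  ≡⟨ cong (f a b c) (shear-odd X (X - Y) (X - Z) refl) ⟩
        f a b c (oddPoint (X , X - (X - Y) , X - (X - Z)))
          ≡⟨ cong (λ p → f a b c (oddPoint p)) (triple-≡ (refl {x = X}) (back X Y) (back X Z)) ⟩
        f a b c (oddPoint (X , Y , Z))    ≡⟨ oddPoint-solves (X , Y , Z) e ⟩
        N                                 ∎

      from-ok : ∀ w → g a b c w ≡ N → twiceTri a b c (from w) ≡ m
      from-ok (x , y , z) e = oddPoint-solves⁻¹ (from (x , y , z))
        (trans (cong (f a b c) (sym (shear-odd ⌈ x /2⌉ y z (first-odd x y z e)))) e)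

      to∘from : ∀ w → g a b c w ≡ N → to (from w) ≡ w
      to∘from (x , y , z) e =
        triple-≡ (sym (first-odd x y z e)) (back ⌈ x /2⌉ y) (back ⌈ x /2⌉ z)

      from∘to : ∀ v → twiceTri a b c v ≡ m → from (to v) ≡ v
      from∘to (X , Y , Z) _ = triple-≡ half (trans (cong (_- (X - Y)) half) (back X Y))
                                            (trans (cong (_- (X - Z)) half) (back X Z))
        where
        half : ⌈ + 2 * X - + 1 /2⌉ ≡ X
        half = ⌈/2⌉-odd refl

    f-bijection : Odd (+ a) → (β γ : ℤ) → + b ≡ + a + + 4 * β → + c ≡ + a + + 4 * γ →
      Rep (twiceTri a b c) m ↔ Rep (f a b c) N
    f-bijection oddA β γ b≡ c≡ =
      fibre-↔ {twiceTri a b c} {f a b c} oddPoint halves oddPoint-solves from-ok to∘from from∘to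
      where
      halves : ℤ³ → ℤ³
      halves (u , v , w) = ⌈ u /2⌉ , ⌈ v /2⌉ , ⌈ w /2⌉

      solution-odd : ∀ u v w → f a b c (u , v , w) ≡ N → Odd u × Odd v × Odd w
      solution-odd u v w e = all-odd oddA (parity u) (parity v) (parity w)
        (mod4-reduction {+ a} {+ b} {+ c} {u} {v} {w} β γ m b≡ c≡
                        (parity u) (parity v) (parity w) (trans e N≡))

      to∘from : ∀ w → f a b c w ≡ N → oddPoint (halves w) ≡ w
      to∘from (u , v , w) e with solution-odd u v w e
      ... | oddU , oddV , oddW =
        triple-≡ (sym (odd-⌈/2⌉ oddU)) (sym (odd-⌈/2⌉ oddV)) (sym (odd-⌈/2⌉ oddW))

      from-ok : ∀ w → f a b c w ≡ N → twiceTri a b c (halves w) ≡ m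
      from-ok w e = oddPoint-solves⁻¹ (halves w) (trans (cong (f a b c) (to∘from w e)) e)

      from∘to : ∀ v → twiceTri a b c v ≡ m → halves (oddPoint v) ≡ v
      from∘to (X , Y , Z) _ = triple-≡ (⌈/2⌉-odd refl) (⌈/2⌉-odd refl) (⌈/2⌉-odd refl)

  pos-+₃ : ∀ p q r → + (p ℕ.+ q ℕ.+ r) ≡ + p + + q + + r
  pos-+₃ p q r = trans (pos-+ (p ℕ.+ q) r) (cong (_+ + r) (pos-+ p q))

  target-split : ∀ a b c n → + (8 ℕ.* n ℕ.+ a ℕ.+ b ℕ.+ c) ≡ + 4 * (+ 2 * + n) + (+ a + + b + + c)
  target-split a b c n = begin
    + (8 ℕ.* n ℕ.+ a ℕ.+ b ℕ.+ c)       ≡⟨ pos-+ (8 ℕ.* n ℕ.+ a ℕ.+ b) c ⟩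
    + (8 ℕ.* n ℕ.+ a ℕ.+ b) + + c       ≡⟨ cong (_+ + c) (pos-+₃ (8 ℕ.* n) a b) ⟩
    + (8 ℕ.* n) + + a + + b + + c       ≡⟨ cong (λ t → t + + a + + b + + c) (pos-* 8 n) ⟩
    + 8 * + n + + a + + b + + c         ≡⟨ regroup (+ n) (+ a) (+ b) (+ c) ⟩
    + 4 * (+ 2 * + n) + (+ a + + b + + c) ∎
    where
    regroup : ∀ n A B C → + 8 * n + A + B + C ≡ + 4 * (+ 2 * n) + (A + B + C)
    regroup = solve-∀

  triangular↔g : ∀ a b c n → (a ℕ.+ b ℕ.+ c) % 2 ≡ 1 →
    Rep (twiceTri a b c) (+ 2 * + n) ↔ Rep (g a b c) (+ (8 ℕ.* n ℕ.+ a ℕ.+ b ℕ.+ c))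
  triangular↔g a b c n S%2≡1 with ℕ-odd (a ℕ.+ b ℕ.+ c) S%2≡1
  ... | σ , S≡ =
    g-bijection a b c (+ 2 * + n) _ (target-split a b c n) (σ , trans (sym (pos-+₃ a b c)) S≡)

  triangular↔f : ∀ a b c n → a % 2 ≡ 1 → a % 4 ≡ b % 4 → a % 4 ≡ c % 4 →
    Rep (twiceTri a b c) (+ 2 * + n) ↔ Rep (f a b c) (+ (8 ℕ.* n ℕ.+ a ℕ.+ b ℕ.+ c))
  triangular↔f a b c n a%2≡1 a≡b a≡c with ℕ-≡-mod4 a b a≡b | ℕ-≡-mod4 a c a≡c
  ... | β , b≡ | γ , c≡ =
    f-bijection a b c (+ 2 * + n) _ (target-split a b c n) (ℕ-odd a a%2≡1) β γ b≡ c≡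

open Fibres using (triangular↔g; triangular↔f)
open import Data.Nat using (ℕ; _%_; _+_; _*_; _>_)
open import Data.Nat.GCD using (gcd)
open import Data.Integer using (+_)
open import Data.Product using (_×_)

lemma2p1 : (a b c : ℕ) → a > 0 → b > 0 → c > 0 →
    gcd (gcd a b) c ≡ 1 → a % 2 ≡ 1 → (a + b + c) % 2 ≡ 1 →
    (n : ℕ) → n > 0 →
      ((k : ℕ) → t≡ a b c (+ n) k → r≡ (g a b c) (+ (8 * n + a + b + c)) k)
      × (a % 4 ≡ b % 4 → b % 4 ≡ c % 4 →
          (k : ℕ) → t≡ a b c (+ n) k → r≡ (f a b c) (+ (8 * n + a + b + c)) k)
lemma2p1 a b c _ _ _ _ a%2≡1 S%2≡1 n _ =
    (λ k count → triangular↔g a b c n S%2≡1 ↔-∘ count)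
  , (λ a≡b b≡c k count → triangular↔f a b c n a%2≡1 a≡b (trans a≡b b≡c) ↔-∘ count)
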